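{- Let $\alpha$ be a non-degenerate $(s+2t)$-simplex with vertices among the vertices of $\Pi^*_{s,t}$, and let $\sigma$ be an exterior $k$-face of $\alpha$, lying in the $k$-dimensional face $G$ of $\Pi^*_{s,t}$. Then any face of $\Pi^*_{s,t}$ that is parallel to $G$ and distinct from $G$ contains at most one vertex of $\alpha$.
   Context: $\Pi^*_{s,t}$ is the product of $s$ copies of $\Delta^1$ and $t$ copies of $\Delta^2$ ($\Delta^d$ the $d$-simplex spanned by the standard unit vectors of $\mathbb{R}^{d+1}$), written in standard coordinates with one block of coordinates per factor (each block nonnegative, summing to $1$); vertices are the $0/1$ points. Non-degenerate means the $s+2t+1$ vertices are affinely independent. An exterior $k$-face of $\alpha$ is a $k$-face of $\alpha$ whose $k+1$ vertices lie in a common $k$-dimensional face of $\Pi^*_{s,t}$. For a subset $A$ of the simplotope, a standard coordinate is a zero coordinate of $A$ if it equals $0$ on all of $A$, a dependent coordinate if it equals $1$ on all of $A$, and a free coordinate otherwise. Two faces of the simplotope are parallel if they have exactly the same free coordinates. -}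

module Defs where

open import Data.Nat using (ℕ; zero; suc; _+_; _*_; _∸_)
open import Data.Fin using (Fin; zero; suc)
open import Data.Fin.Subset using (Subset; _∈_; Nonempty; ∣_∣)
open import Data.Product using (Σ; _×_; _,_; ∃)
open import Data.Sum using (_⊎_; inj₁; inj₂)
open import Data.Rational using (ℚ; 0ℚ; 1ℚ) renaming (_+_ to _+ℚ_; _*_ to _*ℚ_)
open import Relation.Binary.PropositionalEquality using (_≡_)
open import Relation.Nullary using (¬_; yes; no)
open import Data.Fin using (_≟_)

∑ : {A : Set} → (A → A → A) → A → (n : ℕ) → (Fin n → A) → A
∑ _⊕_ e zero    f = e
∑ _⊕_ e (suc n) f = f zero ⊕ ∑ _⊕_ e n (λ i → f (suc i))

∑ℕ : (n : ℕ) → (Fin n → ℕ) → ℕ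
∑ℕ = ∑ _+_ 0

∑ℚ : (n : ℕ) → (Fin n → ℚ) → ℚ
∑ℚ = ∑ _+ℚ_ 0ℚ

-- Π*_{s,t} = (Δ¹)^s × (Δ²)^t.  Standard coordinates: block i of a Δ¹-factor
-- has coordinates (i , j) with j : Fin 2, block i of a Δ²-factor has
-- coordinates (i , j) with j : Fin 3.
Coord : ℕ → ℕ → Set
Coord s t = (Fin s × Fin 2) ⊎ (Fin t × Fin 3)

-- A vertex (0/1 point) selects, in every block, the coordinate equal to 1.
Vertex : ℕ → ℕ → Set
Vertex s t = (Fin s → Fin 2) × (Fin t → Fin 3)

indicator : {m : ℕ} → Fin m → Fin m → ℚ
indicator a b with a ≟ b
... | yes _ = 1ℚ
... | no  _ = 0ℚ

coord : {s t : ℕ} → Vertex s t → Coord s t → ℚ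
coord (u , w) (inj₁ (i , j)) = indicator (u i) j
coord (u , w) (inj₂ (i , j)) = indicator (w i) j

-- Faces of a product of simplices: a product of faces of the factors, i.e.
-- a nonempty set of allowed vertices (coordinates) in every block.
record Face (s t : ℕ) : Set where
  field
    S₁  : Fin s → Subset 2
    S₂  : Fin t → Subset 3
    ne₁ : (i : Fin s) → Nonempty (S₁ i)
    ne₂ : (i : Fin t) → Nonempty (S₂ i)
open Face public

dim : {s t : ℕ} → Face s t → ℕ
dim {s} {t} F = ∑ℕ s (λ i → ∣ S₁ F i ∣ ∸ 1) + ∑ℕ t (λ i → ∣ S₂ F i ∣ ∸ 1)

_∈F_ : {s t : ℕ} → Vertex s t → Face s t → Set
(u , w) ∈F F = ((i : Fin _) → u i ∈ S₁ F i) × ((i : Fin _) → w i ∈ S₂ F i)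

SameFace : {s t : ℕ} → Face s t → Face s t → Set
SameFace {s} {t} F G = ((i : Fin s) → S₁ F i ≡ S₁ G i) × ((i : Fin t) → S₂ F i ≡ S₂ G i)

-- A standard coordinate c is free for the face F if it is neither 0 on all
-- of F nor 1 on all of F.  Since each coordinate is affine and F is the
-- convex hull of its vertices, this is: some vertex of F has c = 1 and some
-- vertex of F has c = 0.
Free : {s t : ℕ} → Face s t → Coord s t → Set
Free {s} {t} F c =
  (Σ (Vertex s t) λ v → v ∈F F × coord v c ≡ 1ℚ) ×
  (Σ (Vertex s t) λ v → v ∈F F × coord v c ≡ 0ℚ)

Parallel : {s t : ℕ} → Face s t → Face s t → Set
Parallel {s} {t} F G = (c : Coord s t) → (Free F c → Free G c) × (Free G c → Free F c)

-- affine independence (over ℚ, which for these rational points agrees with ℝ)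
-- of points p₀,…,p_n : only the trivial affine dependence.
AffinelyIndependent : {s t n : ℕ} → (Fin n → Vertex s t) → Set
AffinelyIndependent {s} {t} {n} p =
  (λ' : Fin n → ℚ) →
  ∑ℚ n λ' ≡ 0ℚ →
  ((c : Coord s t) → ∑ℚ n (λ m → λ' m *ℚ coord (p m) c) ≡ 0ℚ) →
  (m : Fin n) → λ' m ≡ 0ℚ

NonDegSimplex : ℕ → ℕ → Set
NonDegSimplex s t = Σ (Fin (suc (s + 2 * t)) → Vertex s t) AffinelyIndependent

ExteriorFaceIn : {s t : ℕ} → (α : Fin (suc (s + 2 * t)) → Vertex s t) →
  (k : ℕ) → Subset (suc (s + 2 * t)) → Face s t → Set
ExteriorFaceIn α k σ G =
  (∣ σ ∣ ≡ suc k) × (dim G ≡ k) × ((m : Fin _) → m ∈ σ → α m ∈F G)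

module Submission where

-- We work in homogenised coordinates ĥ v = (1, coordinates of v), in which affine relations
-- among vertices become linear ones.

module ParallelFaces where

  open import Defs
  open import Data.Nat using (ℕ; zero; suc; _<_; _∸_; s≤s) renaming (_+_ to _+ℕ_)
  open import Data.Nat.Properties as ℕP using ()
  open import Data.Fin as Fin using (Fin; zero; suc; punchIn)
  open import Data.Fin.Properties using (any?; punchInᵢ≢i)
  open import Data.List using (List; []; _∷_; length; map; _++_; concat; tabulate)
  open import Data.List.Properties using (length-map; length-++)
  open import Data.List.Relation.Unary.All.Properties using (map⁻; ++⁻; concat⁻; tabulate⁻)
  open import Data.Fin.Subset using (Subset; inside; outside; _∈_; _∉_; _⊆_; ∣_∣)
  open import Data.Fin.Subset.Properties using (_∈?_; ⊆-antisym)
  open import Data.Vec.Base using (_∷_; []; here; there)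
  open import Data.Sum using (_⊎_; inj₁; inj₂)
  open import Data.Unit using (⊤; tt)
  open import Data.List.Relation.Unary.All using (All; []; _∷_)
  open import Data.Product using (Σ; ∃; _×_; _,_; proj₁; proj₂)
  open import Data.Empty using (⊥; ⊥-elim)
  open import Data.Vec.Functional using (insertAt; updateAt)
  open import Data.Vec.Functional.Properties
    using (insertAt-lookup; insertAt-punchIn; updateAt-updates; updateAt-minimal)
  open import Data.Rational using (ℚ; 0ℚ; 1ℚ; _+_; _*_; -_; _-_; 1/_; NonZero; ≢-nonZero)
  open import Data.Rational.Properties as ℚP using (_≟_)
  open import Data.Rational.Solver using (module +-*-Solver)
  open import Algebra.Bundles using (CommutativeRing)
  open import Algebra.Properties.CommutativeMonoid.Sum ℚP.+-0-commutativeMonoid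
    using (sum; sum-cong-≗; sum-remove; sum-replicate-zero; ∑-distrib-+)
  open import Algebra.Properties.Semiring.Sum (CommutativeRing.semiring ℚP.+-*-commutativeRing)
    using (*-distribˡ-sum)
  open import Relation.Binary.PropositionalEquality
  open import Relation.Nullary using (¬_; yes; no; ¬?)
  open import Relation.Nullary.Decidable using (decidable-stable)
  open +-*-Solver using (solve; _:=_; _:+_; _:*_; _:-_; :-_; con)

  ∑ℚ≡sum : ∀ n (f : Fin n → ℚ) → ∑ℚ n f ≡ sum f
  ∑ℚ≡sum zero    f = refl
  ∑ℚ≡sum (suc n) f = cong (f zero +_) (∑ℚ≡sum n (λ i → f (suc i)))

  sum-lincomb : ∀ {n} a b (f g : Fin n → ℚ) →
    sum (λ i → a * f i - b * g i) ≡ a * sum f - b * sum g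
  sum-lincomb {zero}  a b f g = solve 2 (λ a b → con 0ℚ := a :* con 0ℚ :- b :* con 0ℚ) refl a b
  sum-lincomb {suc n} a b f g = begin
    (a * f zero - b * g zero) + sum (λ i → a * f (suc i) - b * g (suc i))
      ≡⟨ cong (a * f zero - b * g zero +_) (sum-lincomb a b (λ i → f (suc i)) (λ i → g (suc i))) ⟩
    (a * f zero - b * g zero) + (a * F - b * G)
      ≡⟨ solve 6 (λ a b f₀ g₀ F G → (a :* f₀ :- b :* g₀) :+ (a :* F :- b :* G)
                                    := a :* (f₀ :+ F) :- b :* (g₀ :+ G)) refl a b (f zero) (g zero) F G ⟩
    a * (f zero + F) - b * (g zero + G) ∎
    where
    open ≡-Reasoning
    F G : ℚ
    F = sum (λ i → f (suc i))
    G = sum (λ i → g (suc i))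

  indicator-refl : ∀ {n} (a : Fin n) → indicator a a ≡ 1ℚ
  indicator-refl a with a Fin.≟ a
  ... | yes _  = refl
  ... | no a≢a = ⊥-elim (a≢a refl)

  indicator-≢ : ∀ {n} {a b : Fin n} → a ≢ b → indicator a b ≡ 0ℚ
  indicator-≢ {a = a} {b} a≢b with a Fin.≟ b
  ... | yes a≡b = ⊥-elim (a≢b a≡b)
  ... | no _    = refl

  indicator-1 : ∀ {n} {a b : Fin n} → indicator a b ≡ 1ℚ → a ≡ b
  indicator-1 {a = a} {b} e with a Fin.≟ b
  ... | yes a≡b = a≡b
  ... | no _    = ⊥-elim (0≢1 e)
    where
    0≢1 : 0ℚ ≢ 1ℚ
    0≢1 ()

  sum-indicator : ∀ {n} (a : Fin n) (g : Fin n → ℚ) → sum (λ x → indicator a x * g x) ≡ g a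
  sum-indicator {suc n} a g = begin
    sum (λ x → indicator a x * g x)
      ≡⟨ sum-remove {i = a} (λ x → indicator a x * g x) ⟩
    indicator a a * g a + sum (λ j → indicator a (punchIn a j) * g (punchIn a j))
      ≡⟨ cong₂ _+_ (cong (_* g a) (indicator-refl a)) (sum-cong-≗ off-a) ⟩
    1ℚ * g a + sum {n} (λ _ → 0ℚ)
      ≡⟨ cong₂ _+_ (ℚP.*-identityˡ (g a)) (sum-replicate-zero n) ⟩
    g a + 0ℚ
      ≡⟨ ℚP.+-identityʳ (g a) ⟩
    g a ∎
    where
    open ≡-Reasoning
    off-a : ∀ j → indicator a (punchIn a j) * g (punchIn a j) ≡ 0ℚ
    off-a j = trans (cong (_* g (punchIn a j)) (indicator-≢ (λ e → punchInᵢ≢i a j (sym e))))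
                    (ℚP.*-zeroˡ (g (punchIn a j)))

  *-≢0 : ∀ {p q} → p ≢ 0ℚ → q ≢ 0ℚ → p * q ≢ 0ℚ
  *-≢0 {p} {q} p≢0 q≢0 pq≡0 = q≢0 (begin
    q              ≡⟨ sym (ℚP.*-identityˡ q) ⟩
    1ℚ * q         ≡⟨ cong (_* q) (sym (ℚP.*-inverseˡ p)) ⟩
    (p⁻¹ * p) * q  ≡⟨ ℚP.*-assoc p⁻¹ p q ⟩
    p⁻¹ * (p * q)  ≡⟨ cong (p⁻¹ *_) pq≡0 ⟩
    p⁻¹ * 0ℚ       ≡⟨ ℚP.*-zeroʳ p⁻¹ ⟩
    0ℚ             ∎)
    where
    open ≡-Reasoning
    instance p-nonZero : NonZero p
    p-nonZero = ≢-nonZero p≢0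
    p⁻¹ : ℚ
    p⁻¹ = 1/ p

  lincomb-zero : ∀ a b {x y} → x ≡ 0ℚ → y ≡ 0ℚ → a * x - b * y ≡ 0ℚ
  lincomb-zero a b refl refl = solve 2 (λ a b → a :* con 0ℚ :- b :* con 0ℚ := con 0ℚ) refl a b

  Closed : {C : Set} → ((C → ℚ) → Set) → Set
  Closed {C} W = ∀ a b {w w′ : C → ℚ} → W w → W w′ → W (λ x → a * w x - b * w′ x)

  -- Every function of W that vanishes at the points ps vanishes everywhere: evaluation at ps is
  -- injective on W, so dim W ≤ length ps.
  DeterminedBy : {C : Set} → ((C → ℚ) → Set) → List C → Set
  DeterminedBy {C} W ps = ∀ {w} → W w → All (λ c → w c ≡ 0ℚ) ps → ∀ x → w x ≡ 0ℚ

  LinearlyDependent : {C : Set} (m : ℕ) → (Fin m → C → ℚ) → Set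
  LinearlyDependent m v =
    Σ (Fin m → ℚ) λ l → (∃ λ i → l i ≢ 0ℚ) × (∀ x → sum (λ i → l i * v i x) ≡ 0ℚ)

  ZeroAt : {C : Set} → ((C → ℚ) → Set) → C → (C → ℚ) → Set
  ZeroAt W c w = W w × w c ≡ 0ℚ

  zeroAt-closed : ∀ {C} {W : (C → ℚ) → Set} {c} → Closed W → Closed (ZeroAt W c)
  zeroAt-closed cl a b (w∈W , wc≡0) (w′∈W , w′c≡0) = cl a b w∈W w′∈W , lincomb-zero a b wc≡0 w′c≡0

  zeroAt-determined : ∀ {C} {W : (C → ℚ) → Set} {c ps} →
    DeterminedBy W (c ∷ ps) → DeterminedBy (ZeroAt W c) ps
  zeroAt-determined det (w∈W , wc≡0) zeros = det w∈W (wc≡0 ∷ zeros)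

  -- Gaussian elimination step: let p = v j c ≠ 0.  A relation μ among the functions
  -- u i = p · v (πᵢ) − v (πᵢ) c · v j  (πᵢ = punchIn j i ranging over the indices ≠ j)
  -- gives the relation  l = μ·p  at the πᵢ  and  l j = − Σᵢ μᵢ · v (πᵢ) c  among the v.
  eliminate : ∀ {C : Set} {m} (v : Fin (suc m) → C → ℚ) (j : Fin (suc m)) (c : C) → v j c ≢ 0ℚ →
    LinearlyDependent m (λ i x → v j c * v (punchIn j i) x - v (punchIn j i) c * v j x) →
    LinearlyDependent (suc m) v
  eliminate {C} {m} v j c p≢0 (μ , (i₀ , μi₀≢0) , μ-rel) = l , (punchIn j i₀ , l-nonzero) , l-rel
    where
    open ≡-Reasoning
    p : ℚ
    p = v j c
    vπ : Fin m → C → ℚ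
    vπ i = v (punchIn j i)
    S : ℚ
    S = sum (λ i → μ i * vπ i c)
    l : Fin (suc m) → ℚ
    l = insertAt (λ i → μ i * p) j (- S)

    l-nonzero : l (punchIn j i₀) ≢ 0ℚ
    l-nonzero = subst (_≢ 0ℚ) (sym (insertAt-punchIn (λ i → μ i * p) j (- S) i₀)) (*-≢0 μi₀≢0 p≢0)

    l-rel : ∀ x → sum (λ i → l i * v i x) ≡ 0ℚ
    l-rel x = begin
      sum (λ i → l i * v i x)
        ≡⟨ sum-remove {i = j} (λ i → l i * v i x) ⟩
      l j * v j x + sum (λ i → l (punchIn j i) * vπ i x)
        ≡⟨ cong₂ _+_ (cong (_* v j x) (insertAt-lookup _ j (- S)))
                     (sum-cong-≗ λ i → cong (_* vπ i x) (insertAt-punchIn _ j (- S) i)) ⟩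
      - S * v j x + sum (λ i → μ i * p * vπ i x)
        ≡⟨ cong (- S * v j x +_) (sum-cong-≗ λ i →
             solve 3 (λ μ p y → μ :* p :* y := p :* (μ :* y)) refl (μ i) p (vπ i x)) ⟩
      - S * v j x + sum (λ i → p * (μ i * vπ i x))
        ≡⟨ cong (- S * v j x +_) (sym (*-distribˡ-sum p (λ i → μ i * vπ i x))) ⟩
      - S * v j x + p * sum (λ i → μ i * vπ i x)
        ≡⟨ solve 4 (λ p S y A → :- S :* y :+ p :* A := p :* A :- y :* S)
                   refl p S (v j x) (sum (λ i → μ i * vπ i x)) ⟩
      p * sum (λ i → μ i * vπ i x) - v j x * S
        ≡⟨ sym (sum-lincomb p (v j x) (λ i → μ i * vπ i x) (λ i → μ i * vπ i c)) ⟩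
      sum (λ i → p * (μ i * vπ i x) - v j x * (μ i * vπ i c))
        ≡⟨ sum-cong-≗ (λ i → solve 5 (λ p μ y z w → p :* (μ :* y) :- w :* (μ :* z) := μ :* (p :* y :- z :* w))
                                      refl p (μ i) (vπ i x) (vπ i c) (v j x)) ⟩
      sum (λ i → μ i * (p * vπ i x - vπ i c * v j x))
        ≡⟨ μ-rel x ⟩
      0ℚ ∎

  -- By induction on the points; at the point c either all v i vanish (so they lie in the
  -- smaller subspace ZeroAt W c) or one of them, v j, does not and is eliminated.
  dependent : ∀ {C} {W : (C → ℚ) → Set} (ps : List C) → Closed W → DeterminedBy W ps →
    ∀ {m} → length ps < m → (v : Fin m → C → ℚ) → (∀ i → W (v i)) → LinearlyDependent m v
  dependent [] cl det {suc m} _ v v∈W = indicator zero , (zero , λ ()) , λ x →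
    trans (sum-indicator zero (λ i → v i x)) (det (v∈W zero) [] x)
  dependent {C} {W} (c ∷ ps) cl det {suc m} (s≤s len) v v∈W with any? (λ i → ¬? (v i c ≟ 0ℚ))
  ... | no none = dependent ps (zeroAt-closed cl) (zeroAt-determined det) (ℕP.m≤n⇒m≤1+n len) v
                    (λ i → v∈W i , decidable-stable (v i c ≟ 0ℚ) (λ vic≢0 → none (i , vic≢0)))
  ... | yes (j , p≢0) = eliminate v j c p≢0
                          (dependent ps (zeroAt-closed cl) (zeroAt-determined det) len u u∈W′)
    where
    p : ℚ
    p = v j c
    u : Fin m → C → ℚ
    u i x = p * v (punchIn j i) x - v (punchIn j i) c * v j x
    u∈W′ : ∀ i → ZeroAt W c (u i)
    u∈W′ i = cl p (v (punchIn j i) c) (v∈W (punchIn j i)) (v∈W j) ,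
             solve 2 (λ p q → p :* q :- q :* p := con 0ℚ) refl p (v (punchIn j i) c)

  members : ∀ {n} → Subset n → List (Fin n)
  members []            = []
  members (inside ∷ S)  = zero ∷ map suc (members S)
  members (outside ∷ S) = map suc (members S)

  others : ∀ {n} → Subset n → List (Fin n)
  others []            = []
  others (inside ∷ S)  = map suc (members S)
  others (outside ∷ S) = map suc (others S)

  length-members : ∀ {n} (S : Subset n) → length (members S) ≡ ∣ S ∣
  length-members []            = refl
  length-members (inside ∷ S)  = cong suc (trans (length-map suc (members S)) (length-members S))
  length-members (outside ∷ S) = trans (length-map suc (members S)) (length-members S)

  length-others : ∀ {n} (S : Subset n) → length (others S) ≡ ∣ S ∣ ∸ 1
  length-others []            = refl
  length-others (inside ∷ S)  = trans (length-map suc (members S)) (length-members S)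
  length-others (outside ∷ S) = trans (length-map suc (others S)) (length-others S)

  members-complete : ∀ {n} {P : Fin n → Set} (S : Subset n) → All P (members S) → ∀ {j} → j ∈ S → P j
  members-complete (inside ∷ S)  (Pz ∷ _) here          = Pz
  members-complete (inside ∷ S)  (_ ∷ Ps) (there j∈S)   = members-complete S (map⁻ Ps) j∈S
  members-complete (outside ∷ S) Ps       (there j∈S)   = members-complete S (map⁻ Ps) j∈S

  block-zero : ∀ {n} (S : Subset n) (w : Fin n → ℚ) → (∀ j → j ∉ S → w j ≡ 0ℚ) → sum w ≡ 0ℚ →
    All (λ j → w j ≡ 0ℚ) (others S) → ∀ j → w j ≡ 0ℚ
  block-zero (outside ∷ S) w off total zeros = λ { zero → w₀≡0 ; (suc j) → rest j }
    where
    w₀≡0 : w zero ≡ 0ℚ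
    w₀≡0 = off zero λ ()
    tail-total : sum (λ j → w (suc j)) ≡ 0ℚ
    tail-total = begin
      sum (λ j → w (suc j))           ≡⟨ sym (ℚP.+-identityˡ _) ⟩
      0ℚ + sum (λ j → w (suc j))      ≡⟨ cong (_+ sum (λ j → w (suc j))) (sym w₀≡0) ⟩
      sum w                           ≡⟨ total ⟩
      0ℚ                              ∎
      where open ≡-Reasoning
    rest : ∀ j → w (suc j) ≡ 0ℚ
    rest = block-zero S (λ j → w (suc j)) (λ j j∉S → off (suc j) λ { (there j∈S) → j∉S j∈S })
             tail-total (map⁻ zeros)
  block-zero {suc n} (inside ∷ S) w off total zeros = λ { zero → w₀≡0 ; (suc j) → rest j }
    where
    rest : ∀ j → w (suc j) ≡ 0ℚ
    rest j with j ∈? S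
    ... | yes j∈S = members-complete S (map⁻ zeros) j∈S
    ... | no j∉S  = off (suc j) λ { (there j∈S) → j∉S j∈S }
    w₀≡0 : w zero ≡ 0ℚ
    w₀≡0 = begin
      w zero                          ≡⟨ sym (ℚP.+-identityʳ (w zero)) ⟩
      w zero + 0ℚ                     ≡⟨ cong (w zero +_) (sym (sum-replicate-zero n)) ⟩
      w zero + sum {n} (λ _ → 0ℚ)     ≡⟨ cong (w zero +_) (sum-cong-≗ λ j → sym (rest j)) ⟩
      sum w                           ≡⟨ total ⟩
      0ℚ                              ∎
      where open ≡-Reasoning

  -- Homogenised coordinates: an extra coordinate ★ with value 1 next to the standard ones.
  -- Affine relations among vertices are linear relations among their homogenised coordinates.
  HCoord : ℕ → ℕ → Set
  HCoord s t = ⊤ ⊎ Coord s t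

  ★ : ∀ {s t} → HCoord s t
  ★ = inj₁ tt

  c₁ : ∀ {s t} → Fin s → Fin 2 → HCoord s t
  c₁ i j = inj₂ (inj₁ (i , j))

  c₂ : ∀ {s t} → Fin t → Fin 3 → HCoord s t
  c₂ i j = inj₂ (inj₂ (i , j))

  hom : ∀ {s t} → Vertex s t → HCoord s t → ℚ
  hom v (inj₁ _) = 1ℚ
  hom v (inj₂ c) = coord v c

  -- The linear span of the homogenised vertices of a face G: in every block the function
  -- vanishes off G and its coordinates add up to the value at ★.
  record FaceSpace {s t} (G : Face s t) (w : HCoord s t → ℚ) : Set where
    field
      off₁ : ∀ i j → j ∉ S₁ G i → w (c₁ i j) ≡ 0ℚ
      off₂ : ∀ i j → j ∉ S₂ G i → w (c₂ i j) ≡ 0ℚ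
      sum₁ : ∀ i → sum (λ j → w (c₁ i j)) ≡ w ★
      sum₂ : ∀ i → sum (λ j → w (c₂ i j)) ≡ w ★

  faceSpace-closed : ∀ {s t} (G : Face s t) → Closed (FaceSpace G)
  faceSpace-closed G a b {w} {w′} W W′ = record
    { off₁ = λ i j j∉G → lincomb-zero a b (off₁ W i j j∉G) (off₁ W′ i j j∉G)
    ; off₂ = λ i j j∉G → lincomb-zero a b (off₂ W i j j∉G) (off₂ W′ i j j∉G)
    ; sum₁ = λ i → trans (sum-lincomb a b (λ j → w (c₁ i j)) (λ j → w′ (c₁ i j)))
                         (cong₂ (λ x y → a * x - b * y) (sum₁ W i) (sum₁ W′ i))
    ; sum₂ = λ i → trans (sum-lincomb a b (λ j → w (c₂ i j)) (λ j → w′ (c₂ i j)))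
                         (cong₂ (λ x y → a * x - b * y) (sum₂ W i) (sum₂ W′ i))
    }
    where open FaceSpace

  sum-indicator-1 : ∀ {n} (a : Fin n) → sum (indicator a) ≡ 1ℚ
  sum-indicator-1 a = trans (sum-cong-≗ λ x → sym (ℚP.*-identityʳ (indicator a x)))
                            (sum-indicator a (λ _ → 1ℚ))

  hom∈faceSpace : ∀ {s t} {G : Face s t} (v : Vertex s t) → v ∈F G → FaceSpace G (hom v)
  hom∈faceSpace {G = G} (u , w) (u∈G , w∈G) = record
    { off₁ = λ i j j∉G → indicator-≢ λ uᵢ≡j → j∉G (subst (_∈ S₁ G i) uᵢ≡j (u∈G i))
    ; off₂ = λ i j j∉G → indicator-≢ λ wᵢ≡j → j∉G (subst (_∈ S₂ G i) wᵢ≡j (w∈G i))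
    ; sum₁ = λ i → sum-indicator-1 (u i)
    ; sum₂ = λ i → sum-indicator-1 (w i)
    }

  -- dim G + 1 points determining FaceSpace G: ★ and, in every block, the vertices of G but the least.
  blockPoints₁ : ∀ {s t} → Face s t → List (HCoord s t)
  blockPoints₁ G = concat (tabulate λ i → map (c₁ i) (others (S₁ G i)))

  blockPoints₂ : ∀ {s t} → Face s t → List (HCoord s t)
  blockPoints₂ G = concat (tabulate λ i → map (c₂ i) (others (S₂ G i)))

  spanPoints : ∀ {s t} → Face s t → List (HCoord s t)
  spanPoints G = ★ ∷ (blockPoints₁ G ++ blockPoints₂ G)

  length-concat-tabulate : ∀ {A : Set} n (f : Fin n → List A) (g : Fin n → ℕ) →
    (∀ i → length (f i) ≡ g i) → length (concat (tabulate f)) ≡ ∑ℕ n g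
  length-concat-tabulate zero    f g len = refl
  length-concat-tabulate (suc n) f g len =
    trans (length-++ (f zero))
          (cong₂ _+ℕ_ (len zero) (length-concat-tabulate n (λ i → f (suc i)) (λ i → g (suc i)) (λ i → len (suc i))))

  length-spanPoints : ∀ {s t} (G : Face s t) → length (spanPoints G) ≡ suc (dim G)
  length-spanPoints {s} {t} G = cong suc (trans (length-++ (blockPoints₁ G))
    (cong₂ _+ℕ_ (length-concat-tabulate s _ _ λ i → trans (length-map (c₁ i) (others (S₁ G i))) (length-others (S₁ G i)))
                (length-concat-tabulate t _ _ λ i → trans (length-map (c₂ i) (others (S₂ G i))) (length-others (S₂ G i)))))

  faceSpace-determined : ∀ {s t} (G : Face s t) → DeterminedBy (FaceSpace G) (spanPoints G)
  faceSpace-determined {s} {t} G {w} W (w★≡0 ∷ zeros) = λ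
    { (inj₁ tt)             → w★≡0
    ; (inj₂ (inj₁ (i , j))) → block-zero (S₁ G i) (λ j → w (c₁ i j)) (off₁ W i) (trans (sum₁ W i) w★≡0)
                                (map⁻ (tabulate⁻ (concat⁻ zeros₁) i)) j
    ; (inj₂ (inj₂ (i , j))) → block-zero (S₂ G i) (λ j → w (c₂ i j)) (off₂ W i) (trans (sum₂ W i) w★≡0)
                                (map⁻ (tabulate⁻ (concat⁻ zeros₂) i)) j
    }
    where
    open FaceSpace
    zeros₁ : All (λ c → w c ≡ 0ℚ) (blockPoints₁ G)
    zeros₁ = proj₁ (++⁻ (blockPoints₁ G) zeros)
    zeros₂ : All (λ c → w c ≡ 0ℚ) (blockPoints₂ G)
    zeros₂ = proj₂ (++⁻ (blockPoints₁ G) zeros)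

  face-dependent : ∀ {s t m} (G : Face s t) → suc (dim G) < m → (q : Fin m → Vertex s t) → (∀ i → q i ∈F G) →
    LinearlyDependent m (λ i → hom (q i))
  face-dependent {m = m} G dimG<m q q∈G =
    dependent (spanPoints G) (faceSpace-closed G) (faceSpace-determined G)
      (subst (_< m) (sym (length-spanPoints G)) dimG<m) (λ i → hom (q i)) (λ i → hom∈faceSpace (q i) (q∈G i))

  free₁⇒∈ : ∀ {s t} {B : Face s t} {i x} → Free B (inj₁ (i , x)) → x ∈ S₁ B i
  free₁⇒∈ {B = B} {i} ((v , v∈B , vᵢ=x) , _) = subst (_∈ S₁ B i) (indicator-1 vᵢ=x) (proj₁ v∈B i)

  free₂⇒∈ : ∀ {s t} {B : Face s t} {i x} → Free B (inj₂ (i , x)) → x ∈ S₂ B i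
  free₂⇒∈ {B = B} {i} ((v , v∈B , vᵢ=x) , _) = subst (_∈ S₂ B i) (indicator-1 vᵢ=x) (proj₂ v∈B i)

  differ₁⇒free : ∀ {s t} {A : Face s t} {v v′ : Vertex s t} {i x} → v ∈F A → v′ ∈F A →
    proj₁ v i ≡ x → proj₁ v′ i ≢ x → Free A (inj₁ (i , x))
  differ₁⇒free {v = v} {v′} {i} v∈A v′∈A refl v′ᵢ≢x =
    (v , v∈A , indicator-refl (proj₁ v i)) , (v′ , v′∈A , indicator-≢ v′ᵢ≢x)

  differ₂⇒free : ∀ {s t} {A : Face s t} {v v′ : Vertex s t} {i x} → v ∈F A → v′ ∈F A →
    proj₂ v i ≡ x → proj₂ v′ i ≢ x → Free A (inj₂ (i , x))
  differ₂⇒free {v = v} {v′} {i} v∈A v′∈A refl v′ᵢ≢x =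
    (v , v∈A , indicator-refl (proj₂ v i)) , (v′ , v′∈A , indicator-≢ v′ᵢ≢x)

  updateAt-∈ : ∀ {n k} (S : Fin n → Subset k) (u : Fin n → Fin k) i {x} →
    (∀ j → u j ∈ S j) → x ∈ S i → ∀ j → updateAt u i (λ _ → x) j ∈ S j
  updateAt-∈ S u i u∈S x∈S j with j Fin.≟ i
  ... | yes refl = subst (_∈ S i) (sym (updateAt-updates i u)) x∈S
  ... | no j≢i   = subst (_∈ S j) (sym (updateAt-minimal j i u j≢i)) (u∈S j)

  -- If every free coordinate of A is free in B and A, B share a vertex v, then A ⊆ B blockwise:
  -- a vertex x ≠ vᵢ of block i of A gives the free coordinate (i , x) of A, hence of B.
  free⊆⇒⊆₁ : ∀ {s t} {A B : Face s t} → (∀ c → Free A c → Free B c) →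
    (v : Vertex s t) → v ∈F A → v ∈F B → ∀ i → S₁ A i ⊆ S₁ B i
  free⊆⇒⊆₁ {A = A} {B} A⇒B (u , w) (u∈A , w∈A) (u∈B , _) i {x} x∈A with u i Fin.≟ x
  ... | yes refl = u∈B i
  ... | no uᵢ≢x  = free₁⇒∈ {B = B} (A⇒B (inj₁ (i , x)) (differ₁⇒free {A = A} {v = updateAt u i (λ _ → x) , w}
                      (updateAt-∈ (S₁ A) u i u∈A x∈A , w∈A) (u∈A , w∈A) (updateAt-updates i u) uᵢ≢x))

  free⊆⇒⊆₂ : ∀ {s t} {A B : Face s t} → (∀ c → Free A c → Free B c) →
    (v : Vertex s t) → v ∈F A → v ∈F B → ∀ i → S₂ A i ⊆ S₂ B i
  free⊆⇒⊆₂ {A = A} {B} A⇒B (u , w) (u∈A , w∈A) (_ , w∈B) i {x} x∈A with w i Fin.≟ x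
  ... | yes refl = w∈B i
  ... | no wᵢ≢x  = free₂⇒∈ {B = B} (A⇒B (inj₂ (i , x)) (differ₂⇒free {A = A} {v = u , updateAt w i (λ _ → x)}
                      (u∈A , updateAt-∈ (S₂ A) w i w∈A x∈A) (u∈A , w∈A) (updateAt-updates i w) wᵢ≢x))

  parallel-sharing-vertex : ∀ {s t} (F G : Face s t) → Parallel F G →
    (v : Vertex s t) → v ∈F F → v ∈F G → SameFace F G
  parallel-sharing-vertex F G par v v∈F v∈G =
    (λ i → ⊆-antisym (free⊆⇒⊆₁ {A = F} {G} F⇒G v v∈F v∈G i) (free⊆⇒⊆₁ {A = G} {F} G⇒F v v∈G v∈F i)) ,
    (λ i → ⊆-antisym (free⊆⇒⊆₂ {A = F} {G} F⇒G v v∈F v∈G i) (free⊆⇒⊆₂ {A = G} {F} G⇒F v v∈G v∈F i))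
    where
    F⇒G : ∀ c → Free F c → Free G c
    F⇒G c = proj₁ (par c)
    G⇒F : ∀ c → Free G c → Free F c
    G⇒F c = proj₂ (par c)

  retract : ∀ {n} → Subset n → Fin n → Fin n → Fin n
  retract S d x with x ∈? S
  ... | yes _ = x
  ... | no _  = d

  retract-fixes : ∀ {n} {S : Subset n} {d x} → x ∈ S → retract S d x ≡ x
  retract-fixes {S = S} {d} {x} x∈S with x ∈? S
  ... | yes _  = refl
  ... | no x∉S = ⊥-elim (x∉S x∈S)

  retract-∈ : ∀ {n} {S : Subset n} {d} x → d ∈ S → retract S d x ∈ S
  retract-∈ {S = S} x d∈S with x ∈? S
  ... | yes x∈S = x∈S
  ... | no _    = d∈S

  retract-difference : ∀ {n} (S : Subset n) d (x x′ : Fin n) → (x ≢ x′ → x ∈ S × x′ ∈ S) → ∀ j →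
    indicator (retract S d x) j - indicator (retract S d x′) j ≡ indicator x j - indicator x′ j
  retract-difference S d x x′ differ⇒∈S j with x Fin.≟ x′
  ... | yes refl = trans (ℚP.+-inverseʳ (indicator (retract S d x) j)) (sym (ℚP.+-inverseʳ (indicator x j)))
  ... | no x≢x′  = cong₂ (λ y y′ → indicator y j - indicator y′ j)
                         (retract-fixes (proj₁ (differ⇒∈S x≢x′))) (retract-fixes (proj₂ (differ⇒∈S x≢x′)))

  τ : ∀ {s t} → Face s t → Vertex s t → Vertex s t
  τ G (u , w) = (λ i → retract (S₁ G i) (proj₁ (ne₁ G i)) (u i)) ,
                (λ i → retract (S₂ G i) (proj₁ (ne₂ G i)) (w i))

  τ∈G : ∀ {s t} (G : Face s t) v → τ G v ∈F G
  τ∈G G (u , w) = (λ i → retract-∈ (u i) (proj₂ (ne₁ G i))) , (λ i → retract-∈ (w i) (proj₂ (ne₂ G i)))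

  -- Two vertices of F that differ in some block have their entries there in G, for F ∥ G:
  -- the corresponding coordinate is free in F, hence in G.
  parallel-differ₁ : ∀ {s t} {F G : Face s t} → Parallel F G → ∀ {v v′} → v ∈F F → v′ ∈F F →
    ∀ {i} → proj₁ v i ≢ proj₁ v′ i → proj₁ v i ∈ S₁ G i
  parallel-differ₁ {F = F} {G} par {v} v∈F v′∈F {i} vᵢ≢v′ᵢ =
    free₁⇒∈ {B = G} (proj₁ (par (inj₁ (i , proj₁ v i))) (differ₁⇒free {A = F} v∈F v′∈F refl (λ e → vᵢ≢v′ᵢ (sym e))))

  parallel-differ₂ : ∀ {s t} {F G : Face s t} → Parallel F G → ∀ {v v′} → v ∈F F → v′ ∈F F →
    ∀ {i} → proj₂ v i ≢ proj₂ v′ i → proj₂ v i ∈ S₂ G i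
  parallel-differ₂ {F = F} {G} par {v} v∈F v′∈F {i} vᵢ≢v′ᵢ =
    free₂⇒∈ {B = G} (proj₁ (par (inj₂ (i , proj₂ v i))) (differ₂⇒free {A = F} v∈F v′∈F refl (λ e → vᵢ≢v′ᵢ (sym e))))

  -- For F ∥ G, the retraction onto G preserves differences of vertices of F: it acts on F
  -- as the translation carrying F to G.
  τ-difference : ∀ {s t} {F G : Face s t} → Parallel F G → ∀ {v v′} → v ∈F F → v′ ∈F F →
    ∀ c → hom (τ G v) c - hom (τ G v′) c ≡ hom v c - hom v′ c
  τ-difference par v∈F v′∈F (inj₁ tt) = refl
  τ-difference {F = F} {G} par {v} {v′} v∈F v′∈F (inj₂ (inj₁ (i , j))) =
    retract-difference (S₁ G i) _ (proj₁ v i) (proj₁ v′ i)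
      (λ ne → parallel-differ₁ {F = F} {G} par {v} {v′} v∈F v′∈F ne ,
              parallel-differ₁ {F = F} {G} par {v′} {v} v′∈F v∈F (λ e → ne (sym e))) j
  τ-difference {F = F} {G} par {v} {v′} v∈F v′∈F (inj₂ (inj₂ (i , j))) =
    retract-difference (S₂ G i) _ (proj₂ v i) (proj₂ v′ i)
      (λ ne → parallel-differ₂ {F = F} {G} par {v} {v′} v∈F v′∈F ne ,
              parallel-differ₂ {F = F} {G} par {v′} {v} v′∈F v∈F (λ e → ne (sym e))) j

  independent : ∀ {s t n} {α : Fin n → Vertex s t} → AffinelyIndependent α →
    (l : Fin n → ℚ) → (∀ c → sum (λ x → l x * hom (α x) c) ≡ 0ℚ) → ∀ x → l x ≡ 0ℚ
  independent {n = n} indep l rel = indep l weights≡0 (λ c → trans (∑ℚ≡sum n _) (rel (inj₂ c)))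
    where
    weights≡0 : ∑ℚ n l ≡ 0ℚ
    weights≡0 = trans (∑ℚ≡sum n l) (trans (sum-cong-≗ λ x → sym (ℚP.*-identityʳ (l x))) (rel ★))

  enum : ∀ {n} (σ : Subset n) → Fin ∣ σ ∣ → Fin n
  enum (inside ∷ σ)  zero    = zero
  enum (inside ∷ σ)  (suc j) = suc (enum σ j)
  enum (outside ∷ σ) j       = suc (enum σ j)

  enum-∈ : ∀ {n} (σ : Subset n) j → enum σ j ∈ σ
  enum-∈ (inside ∷ σ)  zero    = here
  enum-∈ (inside ∷ σ)  (suc j) = there (enum-∈ σ j)
  enum-∈ (outside ∷ σ) j       = there (enum-∈ σ j)

  extend : ∀ {n} (σ : Subset n) → (Fin ∣ σ ∣ → ℚ) → Fin n → ℚ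
  extend (inside ∷ σ)  l zero    = l zero
  extend (inside ∷ σ)  l (suc x) = extend σ (λ j → l (suc j)) x
  extend (outside ∷ σ) l zero    = 0ℚ
  extend (outside ∷ σ) l (suc x) = extend σ l x

  extend-enum : ∀ {n} (σ : Subset n) l j → extend σ l (enum σ j) ≡ l j
  extend-enum (inside ∷ σ)  l zero    = refl
  extend-enum (inside ∷ σ)  l (suc j) = extend-enum σ (λ j → l (suc j)) j
  extend-enum (outside ∷ σ) l j       = extend-enum σ l j

  extend-∉ : ∀ {n} (σ : Subset n) l x → x ∉ σ → extend σ l x ≡ 0ℚ
  extend-∉ (inside ∷ σ)  l zero    x∉σ = ⊥-elim (x∉σ here)
  extend-∉ (inside ∷ σ)  l (suc x) x∉σ = extend-∉ σ (λ j → l (suc j)) x (λ x∈σ → x∉σ (there x∈σ))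
  extend-∉ (outside ∷ σ) l zero    x∉σ = refl
  extend-∉ (outside ∷ σ) l (suc x) x∉σ = extend-∉ σ l x (λ x∈σ → x∉σ (there x∈σ))

  extend-sum : ∀ {n} (σ : Subset n) l (g : Fin n → ℚ) →
    sum (λ x → extend σ l x * g x) ≡ sum (λ j → l j * g (enum σ j))
  extend-sum []            l g = refl
  extend-sum (inside ∷ σ)  l g = cong (l zero * g zero +_) (extend-sum σ (λ j → l (suc j)) (λ x → g (suc x)))
  extend-sum (outside ∷ σ) l g = begin
    0ℚ * g zero + rest  ≡⟨ cong (_+ rest) (ℚP.*-zeroˡ (g zero)) ⟩
    0ℚ + rest           ≡⟨ ℚP.+-identityˡ rest ⟩
    rest                ≡⟨ extend-sum σ l (λ x → g (suc x)) ⟩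
    sum (λ j → l j * g (suc (enum σ j))) ∎
    where
    open ≡-Reasoning
    rest : ℚ
    rest = sum (λ x → extend σ l x * g (suc x))

  combine : ∀ a b {P P′ L L′ H H′} → a * P + L ≡ 0ℚ → b * P′ + L′ ≡ 0ℚ → P - P′ ≡ H - H′ →
    (b * L - a * L′) + (a * b * H - a * b * H′) ≡ 0ℚ
  combine a b {P} {P′} {L} {L′} {H} {H′} rel rel′ P-P′≡H-H′ = begin
    (b * L - a * L′) + (a * b * H - a * b * H′)
      ≡⟨ solve 8 (λ a b P P′ L L′ H H′ →
           (b :* L :- a :* L′) :+ (a :* b :* H :- a :* b :* H′)
           := (b :* (a :* P :+ L) :- a :* (b :* P′ :+ L′)) :+ a :* b :* ((H :- H′) :- (P :- P′)))
         refl a b P P′ L L′ H H′ ⟩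
    (b * (a * P + L) - a * (b * P′ + L′)) + a * b * ((H - H′) - (P - P′))
      ≡⟨ cong₂ _+_ (lincomb-zero b a rel rel′) (cong (λ z → a * b * ((H - H′) - z)) P-P′≡H-H′) ⟩
    0ℚ + a * b * ((H - H′) - (H - H′))
      ≡⟨ solve 3 (λ a b D → con 0ℚ :+ a :* b :* (D :- D) := con 0ℚ) refl a b (H - H′) ⟩
    0ℚ ∎
    where open ≡-Reasoning

  sum-combination : ∀ {n} a b (l l′ : Fin n → ℚ) (m m′ : Fin n) (h : Fin n → ℚ) →
    sum (λ x → ((b * l x - a * l′ x) + (a * b * indicator m x - a * b * indicator m′ x)) * h x)
      ≡ (b * sum (λ x → l x * h x) - a * sum (λ x → l′ x * h x)) + (a * b * h m - a * b * h m′)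
  sum-combination a b l l′ m m′ h = begin
    sum (λ x → ((b * l x - a * l′ x) + (a * b * indicator m x - a * b * indicator m′ x)) * h x)
      ≡⟨ sum-cong-≗ (λ x → solve 7 (λ a b l l′ δ δ′ y →
           ((b :* l :- a :* l′) :+ (a :* b :* δ :- a :* b :* δ′)) :* y
           := (b :* (l :* y) :- a :* (l′ :* y)) :+ (a :* b :* (δ :* y) :- a :* b :* (δ′ :* y)))
           refl a b (l x) (l′ x) (indicator m x) (indicator m′ x) (h x)) ⟩
    sum (λ x → (b * (l x * h x) - a * (l′ x * h x))
               + (a * b * (indicator m x * h x) - a * b * (indicator m′ x * h x)))
      ≡⟨ ∑-distrib-+ (λ x → b * (l x * h x) - a * (l′ x * h x))
                     (λ x → a * b * (indicator m x * h x) - a * b * (indicator m′ x * h x)) ⟩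
    sum (λ x → b * (l x * h x) - a * (l′ x * h x))
      + sum (λ x → a * b * (indicator m x * h x) - a * b * (indicator m′ x * h x))
      ≡⟨ cong₂ _+_ (sum-lincomb b a (λ x → l x * h x) (λ x → l′ x * h x))
                   (sum-lincomb (a * b) (a * b) (λ x → indicator m x * h x) (λ x → indicator m′ x * h x)) ⟩
    (b * L - a * L′) + (a * b * sum (λ x → indicator m x * h x) - a * b * sum (λ x → indicator m′ x * h x))
      ≡⟨ cong₂ (λ y y′ → (b * L - a * L′) + (a * b * y - a * b * y′)) (sum-indicator m h) (sum-indicator m′ h) ⟩
    (b * L - a * L′) + (a * b * h m - a * b * h m′) ∎
    where
    open ≡-Reasoning
    L L′ : ℚ
    L  = sum (λ x → l x * h x)
    L′ = sum (λ x → l′ x * h x)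

  module _ {s t n} {α : Fin n → Vertex s t} (indep : AffinelyIndependent α)
           {σ : Subset n} {G : Face s t} (∣σ∣≡dimG+1 : ∣ σ ∣ ≡ suc (dim G))
           (σ⊆G : ∀ x → x ∈ σ → α x ∈F G) where

    record HullRelation (p : Vertex s t) : Set where
      field
        weight    : ℚ
        weight≢0  : weight ≢ 0ℚ
        coeff     : Fin n → ℚ
        supported : ∀ x → x ∉ σ → coeff x ≡ 0ℚ
        relation  : ∀ c → weight * hom p c + sum (λ x → coeff x * hom (α x) c) ≡ 0ℚ

    -- Every vertex p of G lies in the affine hull of α σ: p and α σ are dim G + 2 vertices of G,
    -- hence dependent, and the weight of p is nonzero because α σ alone is independent.
    hullRelation : (p : Vertex s t) → p ∈F G → HullRelation p
    hullRelation p p∈G = record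
      { weight = l zero ; weight≢0 = l₀≢0 ; coeff = coeff ; supported = extend-∉ σ (λ j → l (suc j))
      ; relation = λ c → trans (cong (l zero * hom p c +_) (extend-sum σ (λ j → l (suc j)) (λ x → hom (α x) c)))
                               (l-rel c) }
      where
      q : Fin (suc ∣ σ ∣) → Vertex s t
      q zero    = p
      q (suc j) = α (enum σ j)
      q∈G : ∀ i → q i ∈F G
      q∈G zero    = p∈G
      q∈G (suc j) = σ⊆G (enum σ j) (enum-∈ σ j)
      dependence : LinearlyDependent (suc ∣ σ ∣) (λ i → hom (q i))
      dependence = face-dependent G (ℕP.≤-reflexive (cong suc (sym ∣σ∣≡dimG+1))) q q∈G
      l : Fin (suc ∣ σ ∣) → ℚ
      l = proj₁ dependence
      l-rel : ∀ c → sum (λ i → l i * hom (q i) c) ≡ 0ℚ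
      l-rel = proj₂ (proj₂ dependence)
      coeff : Fin n → ℚ
      coeff = extend σ (λ j → l (suc j))
      l₀≢0 : l zero ≢ 0ℚ
      l₀≢0 l₀≡0 = proj₂ (proj₁ (proj₂ dependence)) (all-zero _)
        where
        coeff-rel : ∀ c → sum (λ x → coeff x * hom (α x) c) ≡ 0ℚ
        coeff-rel c = begin
          sum (λ x → coeff x * hom (α x) c)
            ≡⟨ extend-sum σ (λ j → l (suc j)) (λ x → hom (α x) c) ⟩
          sum (λ j → l (suc j) * hom (q (suc j)) c)
            ≡⟨ sym (ℚP.+-identityˡ _) ⟩
          0ℚ + sum (λ j → l (suc j) * hom (q (suc j)) c)
            ≡⟨ cong (_+ sum (λ j → l (suc j) * hom (q (suc j)) c))
                    (trans (sym (ℚP.*-zeroˡ (hom p c))) (cong (_* hom p c) (sym l₀≡0))) ⟩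
          sum (λ i → l i * hom (q i) c)
            ≡⟨ l-rel c ⟩
          0ℚ ∎
          where open ≡-Reasoning
        all-zero : ∀ i → l i ≡ 0ℚ
        all-zero zero    = l₀≡0
        all-zero (suc j) = trans (sym (extend-enum σ (λ j → l (suc j)) j)) (independent indep coeff coeff-rel (enum σ j))

    -- Let v ≠ v′ be vertices of α in a face F ∥ G with F ≠ G.  With the hull relations
    -- a·ĥ(τv) + L = 0 and b·ĥ(τv′) + L′ = 0, the combination b·L − a·L′ + ab·(ĥ v − ĥ v′)
    -- vanishes because ĥ(τv) − ĥ(τv′) = ĥ v − ĥ v′; it is an affine relation among α with
    -- weight ab ≠ 0 at v (which is not in σ), contradicting independence.
    no-two-vertices : (F : Face s t) → Parallel F G → ¬ SameFace F G →
      ∀ {m m′} → m ≢ m′ → α m ∈F F → α m′ ∈F F → ⊥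
    no-two-vertices F par F≠G {m} {m′} m≢m′ m∈F m′∈F =
      *-≢0 (weight≢0 R) (weight≢0 R′) (trans (sym Λm≡ab) (independent indep Λ Λ-rel m))
      where
      open HullRelation
      R : HullRelation (τ G (α m))
      R = hullRelation (τ G (α m)) (τ∈G G (α m))
      R′ : HullRelation (τ G (α m′))
      R′ = hullRelation (τ G (α m′)) (τ∈G G (α m′))
      a b : ℚ
      a = weight R
      b = weight R′
      Λ : Fin n → ℚ
      Λ x = (b * coeff R x - a * coeff R′ x) + (a * b * indicator m x - a * b * indicator m′ x)

      m∉σ : m ∉ σ
      m∉σ m∈σ = F≠G (parallel-sharing-vertex F G par (α m) m∈F (σ⊆G m m∈σ))

      Λm≡ab : Λ m ≡ a * b
      Λm≡ab = begin
        (b * coeff R m - a * coeff R′ m) + (a * b * indicator m m - a * b * indicator m′ m)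
          ≡⟨ cong₂ _+_ (lincomb-zero b a (supported R m m∉σ) (supported R′ m m∉σ))
                       (cong₂ (λ y y′ → a * b * y - a * b * y′) (indicator-refl m) (indicator-≢ (λ e → m≢m′ (sym e)))) ⟩
        0ℚ + (a * b * 1ℚ - a * b * 0ℚ)
          ≡⟨ solve 1 (λ x → con 0ℚ :+ (x :* con 1ℚ :- x :* con 0ℚ) := x) refl (a * b) ⟩
        a * b ∎
        where open ≡-Reasoning

      Λ-rel : ∀ c → sum (λ x → Λ x * hom (α x) c) ≡ 0ℚ
      Λ-rel c = trans (sum-combination a b (coeff R) (coeff R′) m m′ (λ x → hom (α x) c))
                      (combine a b (relation R c) (relation R′ c) (τ-difference {F = F} {G} par m∈F m′∈F c))

    at-most-one-vertex : (F : Face s t) → Parallel F G → ¬ SameFace F G →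
      ∀ m m′ → α m ∈F F → α m′ ∈F F → m ≡ m′
    at-most-one-vertex F par F≠G m m′ m∈F m′∈F =
      decidable-stable (m Fin.≟ m′) (λ m≢m′ → no-two-vertices F par F≠G m≢m′ m∈F m′∈F)

open import Defs
open import Data.Nat using (ℕ; suc; _+_; _*_)
open import Data.Fin using (Fin)
open import Data.Fin.Subset using (Subset)
open import Data.Product using (proj₁; _,_)
open import Relation.Binary.PropositionalEquality using (_≡_; sym; trans; cong)
open import Relation.Nullary using (¬_)
open ParallelFaces using (at-most-one-vertex)

proposition10 : (s t k : ℕ) (α : NonDegSimplex s t) (σ : Subset (suc (s + 2 * t)))
    (G : Face s t) → ExteriorFaceIn (proj₁ α) k σ G →
    (F : Face s t) → Parallel F G → ¬ SameFace F G →
    (m m′ : Fin (suc (s + 2 * t))) → proj₁ α m ∈F F → proj₁ α m′ ∈F F → m ≡ m′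
proposition10 s t k (α , indep) σ G (∣σ∣≡k+1 , dimG≡k , σ⊆G) =
  at-most-one-vertex indep {σ = σ} {G = G} (trans ∣σ∣≡k+1 (cong suc (sym dimG≡k))) σ⊆G
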